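{- Let $G$ be a connected $P_5$-free chordal bipartite graph with bipartition $(A,B)$, let $(A_1,B_1)$ be a maximum biclique of $G$ with $A_1\subseteq A$, $B_1\subseteq B$, and let $A_2=A\setminus A_1$, $B_2=B\setminus B_1$, $p=|A_2|$, $q=|B_2|$. Then $G$ has a Hamiltonian cycle if and only if (i) $|A|=|B|$, and (ii) $A_2$ has an ordering $(u_1,\dots,u_p)$ such that $d(u_g)>g$ for all $1\le g\le p$, and $B_2$ has an ordering $(v_1,\dots,v_q)$ such that $d(v_h)>h$ for all $1\le h\le q$.
   Context: Graphs are finite, simple and undirected. A bipartite graph is chordal bipartite if every cycle of length at least six has a chord. $P_5$-free means no induced path on five vertices. $d(v)$ is the degree of $v$ in $G$. A biclique is a pair $(X,Y)$ with $X\subseteq A$, $Y\subseteq B$ such that every vertex of $X$ is adjacent to every vertex of $Y$; it is maximal if no vertex can be added to $X$ or to $Y$ keeping this property. Following the paper, a maximum biclique is a maximal biclique $(X,Y)$ for which $\bigl||X|-|Y|\bigr|$ is minimum. -}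

module Defs where

open import Data.Nat using (ℕ; zero; suc; _≤_; _<_; _∸_; _+_) renaming (∣_-_∣ to dist)
open import Data.Bool using (Bool; T)
open import Data.Fin using (Fin; toℕ)
open import Data.Fin.Subset using (Subset; _∈_; _∉_; ⁅_⁆; _∪_; ∁) renaming (∣_∣ to card)
open import Data.Vec using (tabulate)
open import Data.Sum using (_⊎_; inj₁; inj₂)
open import Data.Product using (Σ; ∃; _×_; _,_)
open import Data.Empty using (⊥)
open import Relation.Nullary using (¬_)
open import Relation.Binary.PropositionalEquality using (_≡_)
open import Function.Definitions using (Injective)

-- A bipartite graph with bipartition (A,B), A = Fin m, B = Fin n,
-- given by its (Boolean) biadjacency relation. Finite, simple, undirected.
BG : ℕ → ℕ → Set
BG m n = Fin m → Fin n → Bool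

V : ℕ → ℕ → Set
V m n = Fin m ⊎ Fin n

Adj : ∀ {m n} → BG m n → V m n → V m n → Set
Adj G (inj₁ a) (inj₂ b) = T (G a b)
Adj G (inj₂ b) (inj₁ a) = T (G a b)
Adj G (inj₁ _) (inj₁ _) = ⊥
Adj G (inj₂ _) (inj₂ _) = ⊥

data Walk {m n} (G : BG m n) : V m n → V m n → Set where
  here : ∀ {u} → Walk G u u
  step : ∀ {u v w} → Adj G u v → Walk G v w → Walk G u w

Connected : ∀ {m n} → BG m n → Set
Connected G = ∀ u v → Walk G u v

degA : ∀ {m n} → BG m n → Fin m → ℕ
degA G a = card (tabulate (G a))

degB : ∀ {m n} → BG m n → Fin n → ℕ
degB G b = card (tabulate (λ a → G a b))

PathConsec : Fin 5 → Fin 5 → Set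
PathConsec i j = (toℕ j ≡ suc (toℕ i)) ⊎ (toℕ i ≡ suc (toℕ j))

InducedP5 : ∀ {m n} → BG m n → (Fin 5 → V m n) → Set
InducedP5 G f = Injective _≡_ _≡_ f
  × (∀ i j → PathConsec i j → Adj G (f i) (f j))
  × (∀ i j → Adj G (f i) (f j) → PathConsec i j)

P5Free : ∀ {m n} → BG m n → Set
P5Free G = ∀ f → ¬ InducedP5 G f

CycSucc : (k : ℕ) → Fin k → Fin k → Set
CycSucc k i j = (toℕ j ≡ suc (toℕ i)) ⊎ ((suc (toℕ i) ≡ k) × (toℕ j ≡ 0))

IsCycle : ∀ {m n} → BG m n → (k : ℕ) → (Fin k → V m n) → Set
IsCycle G k f = (3 ≤ k) × Injective _≡_ _≡_ f
  × (∀ i j → CycSucc k i j → Adj G (f i) (f j))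

HasChord : ∀ {m n} → BG m n → (k : ℕ) → (Fin k → V m n) → Set
HasChord G k f = Σ (Fin k) λ i → Σ (Fin k) λ j →
  ¬ CycSucc k i j × ¬ CycSucc k j i × Adj G (f i) (f j)

ChordalBipartite : ∀ {m n} → BG m n → Set
ChordalBipartite G = ∀ k (f : Fin k → V _ _) → 6 ≤ k → IsCycle G k f → HasChord G k f

HamiltonianCycle : ∀ {m n} → BG m n → Set
HamiltonianCycle {m} {n} G = Σ (Fin (m + n) → V m n) λ f →
  IsCycle G (m + n) f × (∀ v → ∃ λ i → f i ≡ v)

Biclique : ∀ {m n} → BG m n → Subset m → Subset n → Set
Biclique G X Y = ∀ a b → a ∈ X → b ∈ Y → T (G a b)

MaximalBiclique : ∀ {m n} → BG m n → Subset m → Subset n → Set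
MaximalBiclique G X Y = Biclique G X Y
  × (∀ a → a ∉ X → ¬ Biclique G (⁅ a ⁆ ∪ X) Y)
  × (∀ b → b ∉ Y → ¬ Biclique G X (⁅ b ⁆ ∪ Y))

-- "maximum biclique" in the sense of the paper: a maximal biclique
-- minimising | |X| - |Y| | among all maximal bicliques
MaximumBiclique : ∀ {m n} → BG m n → Subset m → Subset n → Set
MaximumBiclique {m} {n} G X Y = MaximalBiclique G X Y
  × (∀ (X' : Subset m) (Y' : Subset n) → MaximalBiclique G X' Y' →
       dist (card X) (card Y) ≤ dist (card X') (card Y'))

-- an ordering (u_1,...,u_p) of S ⊆ A (p = |S|) with d(u_g) > g (1-indexed)
GoodOrderA : ∀ {m n} → BG m n → Subset m → Set
GoodOrderA {m} G S = Σ (Fin (card S) → Fin m) λ u →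
  Injective _≡_ _≡_ u × (∀ i → u i ∈ S) × (∀ i → suc (toℕ i) < degA G (u i))

GoodOrderB : ∀ {m n} → BG m n → Subset n → Set
GoodOrderB {m} {n} G S = Σ (Fin (card S) → Fin n) λ v →
  Injective _≡_ _≡_ v × (∀ i → v i ∈ S) × (∀ i → suc (toℕ i) < degB G (v i))

{-# OPTIONS --safe #-}
module Submission where

-- A connected P₅-free bipartite graph has no induced 2K₂, so the neighbourhoods of the
-- vertices of each side are totally ordered by inclusion.  Such a graph has a Hamiltonian
-- cycle iff |A| = |B| and Pósa's condition holds on A: for 0 < k < |A|, fewer than k
-- vertices have degree at most k.  Necessity: the successor map of the cycle sends the
-- low-degree vertices injectively into the neighbourhood N of the largest of them; it cannot
-- be onto N, since then these vertices together with N would be closed under predecessors on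
-- the cycle.  Sufficiency: repeatedly put a vertex of minimum degree next to a vertex that is
-- adjacent to every remaining vertex of A.
-- The orderings of the theorem say exactly that Pósa's condition holds on A₂ and on B₂, and
-- nothing is lost by the restriction: Pósa's condition yields a vertex adjacent to all of B,
-- which lies in A₁; conversely, since A₁ × B₁ is complete, a low-degree vertex in A₁ forces
-- many low-degree vertices in B₂.

open import Defs
open import Data.Nat using (ℕ; _≤_; _+_)
open import Data.Fin.Subset using (Subset; ∁)
open import Data.Product using (_×_)
open import Relation.Binary.PropositionalEquality using (_≡_)
open import Function.Bundles using (_⇔_)

open import Level using (Level)
open import Data.Bool using (Bool; true; false; not; T; if_then_else_)
open import Data.Bool.Properties using (not-¬; not-involutive; T?)
open import Data.Nat using (zero; suc; pred; _<_; _≤?_; z≤n; s≤s)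
import Data.Nat as ℕ
open import Data.Nat.Properties
  using ( ≤-refl; ≤-trans; ≤-antisym; ≤-reflexive; ≤-total; ≤-pred; <⇒≱; ≰⇒>; ≮⇒≥; >⇒≢
        ; ≤-<-trans; <-≤-trans; n<1+n; n≤1+n; m≤n⇒m≤1+n; m≤n⇒∃[o]m+o≡n; pred-cancel-<; suc-injective
        ; +-suc; +-comm; +-cancelʳ-≤; +-cancelˡ-≤; +-monoʳ-≤; +-monoˡ-≤; module ≤-Reasoning )
open import Data.Fin using (Fin; zero; suc; toℕ; fromℕ; inject₁; lower₁; cast; _≟_)
open import Data.Fin.Properties
  using ( any?; toℕ-injective; toℕ-fromℕ; toℕ-inject₁; toℕ-inject₁-≢; toℕ-lower₁; lower₁-inject₁′
        ; toℕ≤pred[n]; injective⇒≤; toℕ-cast; cast-involutive )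
import Data.Fin.Properties as Fin
open import Data.Fin.Induction using (>-weakInduction)
open import Data.Fin.Subset using (inside; outside; ⁅_⁆; _∪_) renaming (_∈_ to _∈ₛ_; ∣_∣ to card)
open import Data.Fin.Subset.Properties
  using (_∈?_; x∈p∪q⁻; x∈⁅y⁆⇒x≡y; x∈p⇒x∉∁p; x∉p⇒x∈∁p; drop-there)
open import Data.Vec using ([]; _∷_; tabulate)
import Data.Vec as Vec
open import Data.List using (List; []; _∷_; _++_; length; lookup)
open import Data.List.Properties using (length-++)
open import Data.List.Membership.Propositional using (_∈_; _∉_)
open import Data.List.Membership.Propositional.Properties using (∈-lookup)
open import Data.List.Relation.Unary.Any using (here; there; index)
open import Data.List.Relation.Unary.Any.Properties using (lookup-index)
open import Data.List.Relation.Unary.All using ([]; _∷_)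
import Data.List.Relation.Unary.All as All
open import Data.List.Relation.Unary.All.Properties using (¬Any⇒All¬)
open import Data.List.Relation.Unary.AllPairs using ([]; _∷_)
open import Data.List.Relation.Unary.Unique.Propositional using (Unique)
open import Data.List.Relation.Unary.Linked using (Linked; []; [-]; _∷_)
open import Data.Product using (Σ; ∃; _,_; proj₁; proj₂)
open import Data.Sum using (_⊎_; inj₁; inj₂; [_,_]; swap; reduce)
open import Data.Sum.Properties using (inj₁-injective; swap-involutive)
open import Data.Empty using (⊥; ⊥-elim)
open import Data.Unit using (tt)
open import Function using (id; _∘_)
open import Function.Definitions using (Injective)
open import Function.Bundles using (mk⇔)
open import Relation.Binary using (Rel; Total; Transitive)
open import Relation.Binary.PropositionalEquality using (_≢_; refl; sym; trans; cong; subst; subst₂)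
open import Relation.Nullary using (¬_; yes; no; does; contradiction; _×-dec_; ¬?)
open import Relation.Unary using (Pred; Decidable; U)
open import Relation.Unary.Properties using (U?; ∁?; _∩?_)

private
  variable
    ℓ ℓ′ : Level
    k m n : ℕ

-- Counting the elements of decidable subsets of Fin n

count : {P : Pred (Fin n) ℓ} → Decidable P → ℕ
count {zero}  _  = 0
count {suc n} P? = (if does (P? zero) then suc else id) (count (P? ∘ suc))

remove? : {P : Pred (Fin n) ℓ} → Decidable P → (x : Fin n) → Decidable (λ i → P i × i ≢ x)
remove? P? x i = P? i ×-dec ¬? (i ≟ x)

count-mono : {P : Pred (Fin n) ℓ} {Q : Pred (Fin n) ℓ′} (P? : Decidable P) (Q? : Decidable Q) →
             (∀ i → P i → Q i) → count P? ≤ count Q?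
count-mono {zero}  P? Q? P⊆Q = z≤n
count-mono {suc n} P? Q? P⊆Q with P? zero | Q? zero | count-mono (P? ∘ suc) (Q? ∘ suc) (P⊆Q ∘ suc)
... | yes p | yes _ | rec = s≤s rec
... | yes p | no ¬q | rec = contradiction (P⊆Q zero p) ¬q
... | no _  | yes _ | rec = m≤n⇒m≤1+n rec
... | no _  | no _  | rec = rec

count-≐ : {P : Pred (Fin n) ℓ} {Q : Pred (Fin n) ℓ′} (P? : Decidable P) (Q? : Decidable Q) →
          (∀ i → P i → Q i) → (∀ i → Q i → P i) → count P? ≡ count Q?
count-≐ P? Q? P⊆Q Q⊆P = ≤-antisym (count-mono P? Q? P⊆Q) (count-mono Q? P? Q⊆P)

count-all : {P : Pred (Fin n) ℓ} (P? : Decidable P) → (∀ i → P i) → count P? ≡ n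
count-all {zero}  P? all = refl
count-all {suc n} P? all with P? zero
... | yes _  = cong suc (count-all (P? ∘ suc) (all ∘ suc))
... | no ¬p = contradiction (all zero) ¬p

count-none : {P : Pred (Fin n) ℓ} (P? : Decidable P) → (∀ i → ¬ P i) → count P? ≡ 0
count-none {zero}  P? none = refl
count-none {suc n} P? none with P? zero
... | yes p = contradiction p (none zero)
... | no _  = count-none (P? ∘ suc) (none ∘ suc)

count-witness : {P : Pred (Fin n) ℓ} (P? : Decidable P) → 0 < count P? → ∃ P
count-witness {suc n} P? pos with P? zero
... | yes p = zero , p
... | no _  = let i , p = count-witness (P? ∘ suc) pos in suc i , p

private
  remove-suc : {P : Pred (Fin (suc n)) ℓ} (P? : Decidable P) (x : Fin n) →
               count (remove? P? (suc x) ∘ suc) ≡ count (remove? (P? ∘ suc) x)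
  remove-suc P? x = count-≐ (remove? P? (suc x) ∘ suc) (remove? (P? ∘ suc) x)
    (λ _ (p , i≢x) → p , i≢x ∘ cong suc) (λ _ (p , i≢x) → p , i≢x ∘ Fin.suc-injective)

count-remove : {P : Pred (Fin n) ℓ} (P? : Decidable P) {x : Fin n} → P x →
               count P? ≡ suc (count (remove? P? x))
count-remove {suc n} P? {zero} p with P? zero
... | no ¬p = contradiction p ¬p
... | yes _ = cong suc (count-≐ (P? ∘ suc) (remove? P? zero ∘ suc) (λ _ p → p , λ ()) (λ _ → proj₁))
count-remove {suc n} P? {suc x} p with P? zero | count-remove (P? ∘ suc) {x} p
... | yes _ | rec = cong suc (trans rec (cong suc (sym (remove-suc P? x))))
... | no _  | rec = trans rec (cong suc (sym (remove-suc P? x)))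

count-remove-≡ : {P : Pred (Fin n) ℓ} (P? : Decidable P) {x : Fin n} → P x →
                 count P? ≡ suc k → count (remove? P? x) ≡ k
count-remove-≡ P? px |P| = suc-injective (trans (sym (count-remove P? px)) |P|)

count-remove-≤ : {P : Pred (Fin n) ℓ} (P? : Decidable P) (x : Fin n) →
                 count P? ≤ suc (count (remove? P? x))
count-remove-≤ P? x with P? x
... | yes p = ≤-reflexive (count-remove P? p)
... | no ¬p = m≤n⇒m≤1+n (count-mono P? (remove? P? x) (λ i p → p , λ { refl → ¬p p }))

count-pos : {P : Pred (Fin n) ℓ} (P? : Decidable P) {x : Fin n} → P x → 0 < count P?
count-pos P? px = ≤-trans (s≤s z≤n) (≤-reflexive (sym (count-remove P? px)))

count≡1⇒unique : {P : Pred (Fin n) ℓ} (P? : Decidable P) → count P? ≡ 1 →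
                  ∀ {x} → P x → ∀ y → P y → y ≡ x
count≡1⇒unique P? |P| {x} px y py with y ≟ x
... | yes y≡x = y≡x
... | no y≢x  = contradiction (count-remove-≡ P? px |P|) (>⇒≢ (count-pos (remove? P? x) (py , y≢x)))

count-complement : {P : Pred (Fin n) ℓ} (P? : Decidable P) → count P? + count (∁? P?) ≡ n
count-complement {zero}  P? = refl
count-complement {suc n} P? with P? zero
... | yes _ = cong suc (count-complement (P? ∘ suc))
... | no _  = trans (+-suc _ _) (cong suc (count-complement (P? ∘ suc)))

count-below : ∀ t → count {n} (∁? (λ i → t ≤? toℕ i)) ≤ t
count-below {zero}  t       = z≤n
count-below {suc n} zero    = ≤-reflexive (count-none {n = suc n} (∁? (λ i → 0 ≤? toℕ i)) (λ i ¬0≤i → ¬0≤i z≤n))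
count-below {suc n} (suc t) = s≤s (≤-trans
  (count-mono {n = n} _ (∁? (λ i → t ≤? toℕ i)) (λ i ¬t<i t≤i → ¬t<i (s≤s t≤i))) (count-below {n} t))

count-partition : {P : Pred (Fin n) ℓ} {Q : Pred (Fin n) ℓ′} (P? : Decidable P) (Q? : Decidable Q) →
                  count (P? ∩? Q?) + count (P? ∩? ∁? Q?) ≡ count P?
count-partition {zero}  P? Q? = refl
count-partition {suc n} P? Q? with P? zero | Q? zero
... | yes _ | yes _ = cong suc (count-partition (P? ∘ suc) (Q? ∘ suc))
... | yes _ | no _  = trans (+-suc _ _) (cong suc (count-partition (P? ∘ suc) (Q? ∘ suc)))
... | no _  | _     = count-partition (P? ∘ suc) (Q? ∘ suc)

count-injective : {P : Pred (Fin m) ℓ} {Q : Pred (Fin n) ℓ′} (P? : Decidable P) (Q? : Decidable Q)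
                  (h : Fin m → Fin n) → (∀ i → P i → Q (h i)) →
                  (∀ {i j} → P i → P j → h i ≡ h j → i ≡ j) → count P? ≤ count Q?
count-injective {zero}  P? Q? h maps inj = z≤n
count-injective {suc m} {P = P} {Q = Q} P? Q? h maps inj with P? zero
... | no _  = count-injective (P? ∘ suc) Q? (h ∘ suc) (maps ∘ suc) (λ p q → Fin.suc-injective ∘ inj p q)
... | yes p = begin
  suc (count (P? ∘ suc))             ≤⟨ s≤s (count-injective (P? ∘ suc) (remove? Q? (h zero)) (h ∘ suc)
                                              maps′ (λ p q → Fin.suc-injective ∘ inj p q)) ⟩
  suc (count (remove? Q? (h zero)))  ≡⟨ count-remove Q? (maps zero p) ⟨
  count Q?                           ∎
  where
  open ≤-Reasoning
  maps′ : ∀ i → P (suc i) → Q (h (suc i)) × h (suc i) ≢ h zero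
  maps′ i q = maps (suc i) q , Fin.0≢1+n ∘ inj p q ∘ sym

count-injective-< : {P : Pred (Fin m) ℓ} {Q : Pred (Fin n) ℓ′} (P? : Decidable P) (Q? : Decidable Q)
                    (h : Fin m → Fin n) → (∀ i → P i → Q (h i)) →
                    (∀ {i j} → P i → P j → h i ≡ h j → i ≡ j) →
                    ∀ {y} → Q y → (∀ i → P i → h i ≢ y) → count P? < count Q?
count-injective-< P? Q? h maps inj {y} qy missed = begin-strict
  count P?                   ≤⟨ count-injective P? (remove? Q? y) h (λ i p → maps i p , missed i p) inj ⟩
  count (remove? Q? y)       <⟨ n<1+n _ ⟩
  suc (count (remove? Q? y)) ≡⟨ count-remove Q? qy ⟨
  count Q?                   ∎
  where open ≤-Reasoning

count-⊂ : {P : Pred (Fin n) ℓ} {Q : Pred (Fin n) ℓ′} (P? : Decidable P) (Q? : Decidable Q) →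
          (∀ i → P i → Q i) → ∀ {y} → Q y → ¬ P y → count P? < count Q?
count-⊂ P? Q? P⊆Q qy ¬py = count-injective-< P? Q? id P⊆Q (λ _ _ → id) qy (λ { i p refl → ¬py p })

count≥n⇒all : {P : Pred (Fin n) ℓ} (P? : Decidable P) → n ≤ count P? → ∀ i → P i
count≥n⇒all {n} P? n≤count i with P? i
... | yes p = p
... | no ¬p = contradiction n≤count (<⇒≱ (begin-strict
  count P?     <⟨ count-⊂ P? U? (λ _ _ → tt) tt ¬p ⟩
  count {n} U? ≡⟨ count-all U? (λ _ → tt) ⟩
  n            ∎))
  where open ≤-Reasoning

count-injective-<⊎onto : {P : Pred (Fin m) ℓ} {Q : Pred (Fin n) ℓ′} (P? : Decidable P) (Q? : Decidable Q)
                        (h : Fin m → Fin n) → (∀ i → P i → Q (h i)) →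
                        (∀ {i j} → P i → P j → h i ≡ h j → i ≡ j) →
                        count P? < count Q? ⊎ (∀ y → Q y → ∃ λ i → P i × h i ≡ y)
count-injective-<⊎onto {P = P} {Q = Q} P? Q? h maps inj
  with any? (λ y → Q? y ×-dec ¬? (any? (λ i → P? i ×-dec (h i ≟ y))))
... | yes (y , qy , ¬hit) = inj₁ (count-injective-< P? Q? h maps inj qy (λ i p e → ¬hit (i , p , e)))
... | no ¬missed          = inj₂ onto
  where
  onto : ∀ y → Q y → ∃ λ i → P i × h i ≡ y
  onto y qy with any? (λ i → P? i ×-dec (h i ≟ y))
  ... | yes hit = hit
  ... | no ¬hit = contradiction (y , qy , ¬hit) ¬missed

module _ {c} {A : Set c} (R : Rel A ℓ′) (total : Total R) (R-trans : Transitive R) where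

  optimum : (f : Fin n → A) {P : Pred (Fin n) ℓ} → Decidable P → ∀ {x} → P x →
            ∃ λ y → P y × (∀ z → P z → R (f y) (f z))
  optimum {suc n} f P? {x} px with any? (P? ∘ suc) | x
  ... | no ¬rest | zero  = zero , px , λ { zero _ → reduce (total _ _) ; (suc z) pz → contradiction (z , pz) ¬rest }
  ... | no ¬rest | suc x = contradiction (x , px) ¬rest
  ... | yes (_ , pi) | _ with optimum (f ∘ suc) (P? ∘ suc) pi | P? zero
  ...   | y , py , best | no ¬p₀ = suc y , py , λ { zero p₀ → contradiction p₀ ¬p₀ ; (suc z) pz → best z pz }
  ...   | y , py , best | yes p₀ with total (f zero) (f (suc y))
  ...     | inj₁ r = zero , p₀ , λ { zero _ → reduce (total _ _) ; (suc z) pz → R-trans r (best z pz) }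
  ...     | inj₂ r = suc y , py , λ { zero _ → r ; (suc z) pz → best z pz }

argmin : (f : Fin n → ℕ) {P : Pred (Fin n) ℓ} → Decidable P → ∀ {x} → P x →
         ∃ λ y → P y × (∀ z → P z → f y ≤ f z)
argmin = optimum _≤_ ≤-total ≤-trans

argmax : (f : Fin n → ℕ) {P : Pred (Fin n) ℓ} → Decidable P → ∀ {x} → P x →
         ∃ λ y → P y × (∀ z → P z → f z ≤ f y)
argmax = optimum (λ u v → v ≤ u) (λ u v → ≤-total v u) (λ p q → ≤-trans q p)

-- Bipartite graphs without induced 2K₂

side : V m n → Bool
side (inj₁ _) = true
side (inj₂ _) = false

_ᵀ : BG m n → BG n m
(G ᵀ) b a = G a b

TwoK2Free : BG m n → Set
TwoK2Free G = ∀ {a a′ b b′} → T (G a b) → T (G a′ b′) → T (G a b′) ⊎ T (G a′ b)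

module _ (G : BG m n) where

  Adj-sym : ∀ u v → Adj G u v → Adj G v u
  Adj-sym (inj₁ _) (inj₂ _) e = e
  Adj-sym (inj₂ _) (inj₁ _) e = e

  Adj-side : ∀ u v → Adj G u v → side u ≡ not (side v)
  Adj-side (inj₁ _) (inj₂ _) _ = refl
  Adj-side (inj₂ _) (inj₁ _) _ = refl

  Adj-irrefl : ∀ u → ¬ Adj G u u
  Adj-irrefl u a = not-¬ refl (Adj-side u u a)

  side-≡⇒¬Adj : ∀ u v → side u ≡ side v → ¬ Adj G u v
  side-≡⇒¬Adj u v e a = not-¬ refl (trans (sym e) (Adj-side u v a))

  Adj-Adj⇒side-≡ : ∀ u v w → Adj G u v → Adj G v w → side u ≡ side w
  Adj-Adj⇒side-≡ u v w a b = trans (Adj-side u v a) (trans (cong not (Adj-side v w b)) (not-involutive _))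

  path5 : V m n → V m n → V m n → V m n → V m n → Fin 5 → V m n
  path5 v₀ v₁ v₂ v₃ v₄ = Vec.lookup (v₀ ∷ v₁ ∷ v₂ ∷ v₃ ∷ v₄ ∷ [])

  module _ {v₀ v₁ v₂ v₃ v₄ : V m n}
           (e₀₁ : Adj G v₀ v₁) (e₁₂ : Adj G v₁ v₂) (e₂₃ : Adj G v₂ v₃) (e₃₄ : Adj G v₃ v₄)
           (¬e₀₃ : ¬ Adj G v₀ v₃) (¬e₁₄ : ¬ Adj G v₁ v₄) where

    private
      s₀₂ : side v₀ ≡ side v₂
      s₀₂ = Adj-Adj⇒side-≡ v₀ v₁ v₂ e₀₁ e₁₂
      s₁₃ : side v₁ ≡ side v₃
      s₁₃ = Adj-Adj⇒side-≡ v₁ v₂ v₃ e₁₂ e₂₃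
      s₂₄ : side v₂ ≡ side v₄
      s₂₄ = Adj-Adj⇒side-≡ v₂ v₃ v₄ e₂₃ e₃₄
      s₀₄ : side v₀ ≡ side v₄
      s₀₄ = trans s₀₂ s₂₄
      v₀≢v₂ : v₀ ≢ v₂
      v₀≢v₂ refl = ¬e₀₃ e₂₃
      v₀≢v₃ : v₀ ≢ v₃
      v₀≢v₃ refl = side-≡⇒¬Adj v₀ v₂ s₀₂ (Adj-sym v₂ v₀ e₂₃)
      v₀≢v₄ : v₀ ≢ v₄
      v₀≢v₄ refl = ¬e₁₄ (Adj-sym v₀ v₁ e₀₁)
      v₁≢v₃ : v₁ ≢ v₃
      v₁≢v₃ refl = ¬e₀₃ e₀₁
      v₁≢v₄ : v₁ ≢ v₄
      v₁≢v₄ refl = side-≡⇒¬Adj v₁ v₃ s₁₃ (Adj-sym v₃ v₁ e₃₄)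
      v₂≢v₄ : v₂ ≢ v₄
      v₂≢v₄ refl = ¬e₁₄ e₁₂
      ≢-Adj : ∀ {u v} → Adj G u v → u ≢ v
      ≢-Adj {u} a refl = Adj-irrefl u a

    induced-path5 : InducedP5 G (path5 v₀ v₁ v₂ v₃ v₄)
    induced-path5 = injective , consecutive⇒Adj , Adj⇒consecutive
      where
      f = path5 v₀ v₁ v₂ v₃ v₄
      injective : ∀ {i j} → f i ≡ f j → i ≡ j
      injective {zero} {zero} _ = refl
      injective {zero} {suc zero} e = contradiction e (≢-Adj e₀₁)
      injective {zero} {suc (suc zero)} e = contradiction e v₀≢v₂
      injective {zero} {suc (suc (suc zero))} e = contradiction e v₀≢v₃
      injective {zero} {suc (suc (suc (suc zero)))} e = contradiction e v₀≢v₄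
      injective {suc zero} {zero} e = contradiction (sym e) (≢-Adj e₀₁)
      injective {suc zero} {suc zero} _ = refl
      injective {suc zero} {suc (suc zero)} e = contradiction e (≢-Adj e₁₂)
      injective {suc zero} {suc (suc (suc zero))} e = contradiction e v₁≢v₃
      injective {suc zero} {suc (suc (suc (suc zero)))} e = contradiction e v₁≢v₄
      injective {suc (suc zero)} {zero} e = contradiction (sym e) v₀≢v₂
      injective {suc (suc zero)} {suc zero} e = contradiction (sym e) (≢-Adj e₁₂)
      injective {suc (suc zero)} {suc (suc zero)} _ = refl
      injective {suc (suc zero)} {suc (suc (suc zero))} e = contradiction e (≢-Adj e₂₃)
      injective {suc (suc zero)} {suc (suc (suc (suc zero)))} e = contradiction e v₂≢v₄
      injective {suc (suc (suc zero))} {zero} e = contradiction (sym e) v₀≢v₃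
      injective {suc (suc (suc zero))} {suc zero} e = contradiction (sym e) v₁≢v₃
      injective {suc (suc (suc zero))} {suc (suc zero)} e = contradiction (sym e) (≢-Adj e₂₃)
      injective {suc (suc (suc zero))} {suc (suc (suc zero))} _ = refl
      injective {suc (suc (suc zero))} {suc (suc (suc (suc zero)))} e = contradiction e (≢-Adj e₃₄)
      injective {suc (suc (suc (suc zero)))} {zero} e = contradiction (sym e) v₀≢v₄
      injective {suc (suc (suc (suc zero)))} {suc zero} e = contradiction (sym e) v₁≢v₄
      injective {suc (suc (suc (suc zero)))} {suc (suc zero)} e = contradiction (sym e) v₂≢v₄
      injective {suc (suc (suc (suc zero)))} {suc (suc (suc zero))} e = contradiction (sym e) (≢-Adj e₃₄)
      injective {suc (suc (suc (suc zero)))} {suc (suc (suc (suc zero)))} _ = refl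

      up : ∀ i j → toℕ j ≡ suc (toℕ i) → Adj G (f i) (f j)
      up zero (suc zero) _ = e₀₁
      up (suc zero) (suc (suc zero)) _ = e₁₂
      up (suc (suc zero)) (suc (suc (suc zero))) _ = e₂₃
      up (suc (suc (suc zero))) (suc (suc (suc (suc zero)))) _ = e₃₄
      up _ zero ()
      up zero (suc (suc _)) ()
      up (suc zero) (suc zero) ()
      up (suc zero) (suc (suc (suc _))) ()
      up (suc (suc _)) (suc zero) ()
      up (suc (suc zero)) (suc (suc zero)) ()
      up (suc (suc zero)) (suc (suc (suc (suc _)))) ()
      up (suc (suc (suc _))) (suc (suc zero)) ()
      up (suc (suc (suc zero))) (suc (suc (suc zero))) ()
      up (suc (suc (suc (suc zero)))) (suc (suc (suc zero))) ()
      up (suc (suc (suc (suc zero)))) (suc (suc (suc (suc zero)))) ()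

      consecutive⇒Adj : ∀ i j → PathConsec i j → Adj G (f i) (f j)
      consecutive⇒Adj i j (inj₁ e) = up i j e
      consecutive⇒Adj i j (inj₂ e) = Adj-sym (f j) (f i) (up j i e)

      Adj⇒consecutive : ∀ i j → Adj G (f i) (f j) → PathConsec i j
      Adj⇒consecutive zero (suc zero) _ = inj₁ refl
      Adj⇒consecutive (suc zero) (suc (suc zero)) _ = inj₁ refl
      Adj⇒consecutive (suc (suc zero)) (suc (suc (suc zero))) _ = inj₁ refl
      Adj⇒consecutive (suc (suc (suc zero))) (suc (suc (suc (suc zero)))) _ = inj₁ refl
      Adj⇒consecutive (suc zero) zero _ = inj₂ refl
      Adj⇒consecutive (suc (suc zero)) (suc zero) _ = inj₂ refl
      Adj⇒consecutive (suc (suc (suc zero))) (suc (suc zero)) _ = inj₂ refl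
      Adj⇒consecutive (suc (suc (suc (suc zero)))) (suc (suc (suc zero))) _ = inj₂ refl
      Adj⇒consecutive zero (suc (suc (suc zero))) a = contradiction a ¬e₀₃
      Adj⇒consecutive (suc (suc (suc zero))) zero a = contradiction (Adj-sym v₃ v₀ a) ¬e₀₃
      Adj⇒consecutive (suc zero) (suc (suc (suc (suc zero)))) a = contradiction a ¬e₁₄
      Adj⇒consecutive (suc (suc (suc (suc zero)))) (suc zero) a = contradiction (Adj-sym v₄ v₁ a) ¬e₁₄
      Adj⇒consecutive zero zero a = contradiction a (Adj-irrefl v₀)
      Adj⇒consecutive zero (suc (suc zero)) a = contradiction a (side-≡⇒¬Adj v₀ v₂ s₀₂)
      Adj⇒consecutive zero (suc (suc (suc (suc zero)))) a = contradiction a (side-≡⇒¬Adj v₀ v₄ s₀₄)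
      Adj⇒consecutive (suc zero) (suc zero) a = contradiction a (Adj-irrefl v₁)
      Adj⇒consecutive (suc zero) (suc (suc (suc zero))) a = contradiction a (side-≡⇒¬Adj v₁ v₃ s₁₃)
      Adj⇒consecutive (suc (suc zero)) zero a = contradiction a (side-≡⇒¬Adj v₂ v₀ (sym s₀₂))
      Adj⇒consecutive (suc (suc zero)) (suc (suc zero)) a = contradiction a (Adj-irrefl v₂)
      Adj⇒consecutive (suc (suc zero)) (suc (suc (suc (suc zero)))) a = contradiction a (side-≡⇒¬Adj v₂ v₄ s₂₄)
      Adj⇒consecutive (suc (suc (suc zero))) (suc zero) a = contradiction a (side-≡⇒¬Adj v₃ v₁ (sym s₁₃))
      Adj⇒consecutive (suc (suc (suc zero))) (suc (suc (suc zero))) a = contradiction a (Adj-irrefl v₃)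
      Adj⇒consecutive (suc (suc (suc (suc zero)))) zero a = contradiction a (side-≡⇒¬Adj v₄ v₀ (sym s₀₄))
      Adj⇒consecutive (suc (suc (suc (suc zero)))) (suc (suc zero)) a = contradiction a (side-≡⇒¬Adj v₄ v₂ (sym s₂₄))
      Adj⇒consecutive (suc (suc (suc (suc zero)))) (suc (suc (suc (suc zero)))) a = contradiction a (Adj-irrefl v₄)

module _ {G : BG m n} (p5-free : P5Free G) where

  private
    -- Each step of the walk from b to b′ either closes an induced P₅ or moves the 2K₂ along.
    ¬2K2-along-walk : ∀ {a a′ b b′} → Walk G (inj₂ b) (inj₂ b′) → T (G a b) → T (G a′ b′) →
                    ¬ T (G a b′) → ¬ T (G a′ b) → ⊥
    ¬2K2-along-walk here ab a′b′ ¬ab′ ¬a′b = ¬ab′ ab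
    ¬2K2-along-walk {a} {a′} {b} {b′} (step {v = inj₁ w} bw (step {v = inj₂ c} wc rest)) ab a′b′ ¬ab′ ¬a′b
      with T? (G w b′) | T? (G a′ c)
    ... | yes wb′ | _      =
      p5-free _ (induced-path5 G {inj₁ a} {inj₂ b} {inj₁ w} {inj₂ b′} {inj₁ a′} ab bw wb′ a′b′ ¬ab′ ¬a′b)
    ... | no ¬wb′ | yes a′c =
      p5-free _ (induced-path5 G {inj₂ b} {inj₁ w} {inj₂ c} {inj₁ a′} {inj₂ b′} bw wc a′c a′b′ ¬a′b ¬wb′)
    ... | no ¬wb′ | no ¬a′c = ¬2K2-along-walk rest wc a′b′ ¬wb′ ¬a′c

  connected-P5free⇒2K2free : Connected G → TwoK2Free G
  connected-P5free⇒2K2free connected {a} {a′} {b} {b′} ab a′b′ with T? (G a b′) | T? (G a′ b)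
  ... | yes ab′ | _      = inj₁ ab′
  ... | no _    | yes a′b = inj₂ a′b
  ... | no ¬ab′ | no ¬a′b = ⊥-elim (¬2K2-along-walk (connected (inj₂ b) (inj₂ b′)) ab a′b′ ¬ab′ ¬a′b)

degIn : BG m n → {S : Pred (Fin n) ℓ} → Decidable S → Fin m → ℕ
degIn G S? a = count (λ b → S? b ×-dec T? (G a b))

deg : BG m n → Fin m → ℕ
deg G = degIn G U?

TwoK2Free-ᵀ : {G : BG m n} → TwoK2Free G → TwoK2Free (G ᵀ)
TwoK2Free-ᵀ 2K2-free ab a′b′ = swap (2K2-free ab a′b′)

neighbourhoods-nested : {G : BG m n} → TwoK2Free G → {S : Pred (Fin n) ℓ} (S? : Decidable S) →
                        ∀ x y b → degIn G S? x ≤ degIn G S? y → S b → T (G x b) → T (G y b)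
neighbourhoods-nested {G = G} 2K2-free {S} S? x y b dx≤dy sb xb with T? (G y b)
... | yes yb = yb
... | no ¬yb = contradiction dx≤dy (<⇒≱ (count-⊂ _ _ N[y]⊆N[x] (sb , xb) (¬yb ∘ proj₂)))
  where
  N[y]⊆N[x] : ∀ b′ → S b′ × T (G y b′) → S b′ × T (G x b′)
  N[y]⊆N[x] b′ (sb′ , yb′) = sb′ , [ id , (λ yb → contradiction yb ¬yb) ] (2K2-free xb yb′)

-- Pósa's condition and orderings by degree

private
  n≤1+pred[n] : ∀ n → n ≤ suc (pred n)
  n≤1+pred[n] zero    = z≤n
  n≤1+pred[n] (suc n) = ≤-refl

countLow : (Fin m → ℕ) → {S : Pred (Fin m) ℓ} → Decidable S → ℕ → ℕ
countLow d S? t = count (λ a → S? a ×-dec d a ≤? suc t)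

-- Pósa's condition with k = t + 1: for 0 < k < r, fewer than k elements of S have degree at most k.
PosaCondition : ℕ → (Fin m → ℕ) → {S : Pred (Fin m) ℓ} → Decidable S → Set
PosaCondition r d S? = ∀ t → suc t < r → countLow d S? t ≤ t

posa-remove-minimum : ∀ {r} (d d′ : Fin m → ℕ) {S : Pred (Fin m) ℓ} (S? : Decidable S) {x} → S x →
                      (∀ a → S a → d x ≤ d a) → (∀ a → S a → a ≢ x → d a ≤ suc (d′ a)) →
                      PosaCondition (suc r) d S? → PosaCondition r d′ (remove? S? x)
posa-remove-minimum d d′ {S} S? {x} sx minimal drop posa t t<r with d x ≤? suc (suc t)
... | yes x-low = ≤-pred (begin
  suc (countLow d′ (remove? S? x) t) ≤⟨ s≤s (count-mono _ (remove? low? x) lower) ⟩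
  suc (count (remove? low? x))       ≡⟨ count-remove low? (sx , x-low) ⟨
  count low?                         ≤⟨ posa (suc t) (s≤s t<r) ⟩
  suc t                              ∎)
  where
  open ≤-Reasoning
  low? : Decidable (λ a → S a × d a ≤ suc (suc t))
  low? a = S? a ×-dec d a ≤? suc (suc t)
  lower : ∀ a → (S a × a ≢ x) × d′ a ≤ suc t → (S a × d a ≤ suc (suc t)) × a ≢ x
  lower a ((sa , a≢x) , low) = (sa , ≤-trans (drop a sa a≢x) (s≤s low)) , a≢x
... | no ¬x-low = ≤-trans (≤-reflexive (count-none (λ a → remove? S? x a ×-dec d′ a ≤? suc t) none)) z≤n
  where
  none : ∀ a → ¬ ((S a × a ≢ x) × d′ a ≤ suc t)
  none a ((sa , a≢x) , low) = ¬x-low (≤-trans (minimal a sa) (≤-trans (drop a sa a≢x) (s≤s low)))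

posa⇒1<degree : ∀ {r} (d : Fin m → ℕ) {S : Pred (Fin m) ℓ} (S? : Decidable S) →
                PosaCondition (suc (suc r)) d S? → ∀ {a} → S a → 1 < d a
posa⇒1<degree d S? posa sa =
  ≰⇒> (λ d≤1 → <⇒≱ (count-pos (λ a → S? a ×-dec d a ≤? 1) (sa , d≤1)) (posa 0 (s≤s (s≤s z≤n))))

GoodOrdering : (Fin m → ℕ) → Pred (Fin m) ℓ → ℕ → Set ℓ
GoodOrdering {m} d S k = Σ (Fin k → Fin m) λ u →
  Injective _≡_ _≡_ u × (∀ i → S (u i)) × (∀ i → suc (toℕ i) < d (u i))

-- The positions ≥ t of the ordering inject into the vertices of S of degree > t + 1.
ordering⇒posa : (d : Fin m → ℕ) {S : Pred (Fin m) ℓ} (S? : Decidable S) {k : ℕ} →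
                count S? ≡ k → GoodOrdering d S k → ∀ t → countLow d S? t ≤ t
ordering⇒posa d S? {k} |S| (u , u-injective , u∈S , u-degree) t =
  ≤-trans (+-cancelʳ-≤ high (countLow d S? t) early (begin
    countLow d S? t + high ≡⟨ trans (count-partition S? low?) |S| ⟩
    k                     ≡⟨ trans (sym (count-complement late?)) (+-comm (count late?) early) ⟩
    early + count late?   ≤⟨ +-monoʳ-≤ early late≤high ⟩
    early + high          ∎)) (count-below {k} t)
  where
  open ≤-Reasoning
  low? : Decidable (λ a → d a ≤ suc t)
  low? a = d a ≤? suc t
  late? : Decidable (λ (i : Fin k) → t ≤ toℕ i)
  late? i = t ≤? toℕ i
  high early : ℕ
  high = count (S? ∩? ∁? low?)
  early = count (∁? late?)
  late≤high : count late? ≤ high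
  late≤high = count-injective late? (S? ∩? ∁? low?) u
    (λ i t≤i → u∈S i , λ low → <⇒≱ (≤-<-trans (s≤s t≤i) (u-degree i)) low) (λ _ _ → u-injective)

-- A vertex of minimum degree goes first; the rest is ordered for the degrees lowered by one.
posa⇒ordering : (d : Fin m → ℕ) {S : Pred (Fin m) ℓ} (S? : Decidable S) {k : ℕ} →
                count S? ≡ k → PosaCondition (suc k) d S? → GoodOrdering d S k
posa⇒ordering d S? {zero}  _   _    = (λ ()) , (λ { {()} }) , (λ ()) , (λ ())
posa⇒ordering d {S} S? {suc k} |S| posa
  with x , sx , minimal ← argmin d S? (proj₂ (count-witness S? (≤-trans (s≤s z≤n) (≤-reflexive (sym |S|)))))
  with u′ , u′-injective , u′∈S′ , u′-degree ← posa⇒ordering (pred ∘ d) (remove? S? x)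
         (count-remove-≡ S? sx |S|)
         (posa-remove-minimum d (pred ∘ d) S? sx minimal (λ a _ _ → n≤1+pred[n] (d a)) posa)
  = u , u-injective , u∈S , u-degree
  where
  u : Fin (suc k) → Fin _
  u zero    = x
  u (suc i) = u′ i
  u∈S : ∀ i → S (u i)
  u∈S zero    = sx
  u∈S (suc i) = proj₁ (u′∈S′ i)
  u-injective : Injective _≡_ _≡_ u
  u-injective {zero}  {zero}  _ = refl
  u-injective {zero}  {suc j} e = contradiction (sym e) (proj₂ (u′∈S′ j))
  u-injective {suc i} {zero}  e = contradiction e (proj₂ (u′∈S′ i))
  u-injective {suc i} {suc j} e = cong suc (u′-injective e)
  u-degree : ∀ i → suc (toℕ i) < d (u i)
  u-degree zero    = posa⇒1<degree d S? posa sx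
  u-degree (suc i) = pred-cancel-< (u′-degree i)

degIn-remove : (G : BG m n) {S : Pred (Fin n) ℓ} (S? : Decidable S) (a : Fin m) (b : Fin n) →
               degIn G S? a ≤ suc (degIn G (remove? S? b) a)
degIn-remove G S? a b = ≤-trans (count-remove-≤ (λ b′ → S? b′ ×-dec T? (G a b′)) b)
  (s≤s (count-mono _ (λ b′ → remove? S? b b′ ×-dec T? (G a b′)) (λ _ ((sb , ab) , b≢) → (sb , b≢) , ab)))

-- A Hamiltonian cycle forces Pósa's condition

next : Fin k → Fin k
next {suc k} i with k ℕ.≟ toℕ i
... | yes _   = zero
... | no k≢i = suc (lower₁ i k≢i)

next-CycSucc : (i : Fin k) → CycSucc k i (next i)
next-CycSucc {suc k} i with k ℕ.≟ toℕ i
... | yes k≡i = inj₂ (cong suc (sym k≡i) , refl)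
... | no k≢i  = inj₁ (cong suc (toℕ-lower₁ i k≢i))

next-injective : Injective _≡_ _≡_ (next {k})
next-injective {suc k} {i} {j} e with k ℕ.≟ toℕ i | k ℕ.≟ toℕ j
... | yes k≡i | yes k≡j = toℕ-injective (trans (sym k≡i) k≡j)
... | no k≢i  | no k≢j  = toℕ-injective (trans (sym (toℕ-lower₁ i k≢i))
                            (trans (cong toℕ (Fin.suc-injective e)) (toℕ-lower₁ j k≢j)))
... | yes _   | no _    = contradiction e Fin.0≢1+n
... | no _    | yes _   = contradiction (sym e) Fin.0≢1+n

next-inject₁ : (i : Fin k) → next (inject₁ i) ≡ suc i
next-inject₁ {k} i with k ℕ.≟ toℕ (inject₁ i)
... | yes k≡i = contradiction k≡i (toℕ-inject₁-≢ i)
... | no k≢i  = cong suc (lower₁-inject₁′ i k≢i)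

next-fromℕ : next (fromℕ k) ≡ zero
next-fromℕ {k} with k ℕ.≟ toℕ (fromℕ k)
... | yes _  = refl
... | no k≢k = contradiction (sym (toℕ-fromℕ k)) k≢k

-- Go down from i₀ to 0, wrap around to the last position, and go down again.
cycle-closure : (P : Pred (Fin k) ℓ) → (∀ i → P (next i) → P i) → ∀ {i₀} → P i₀ → ∀ j → P j
cycle-closure {suc k} P closed {i₀} p =
  >-weakInduction P (closed (fromℕ k) (subst P (sym next-fromℕ) (before-i₀ zero z≤n)))
    (λ i → closed (inject₁ i) ∘ subst P (sym (next-inject₁ i)))
  where
  before-i₀ : ∀ j → toℕ j ≤ toℕ i₀ → P j
  before-i₀ = >-weakInduction (λ j → toℕ j ≤ toℕ i₀ → P j) last backwards
    where
    last : toℕ (fromℕ k) ≤ toℕ i₀ → P (fromℕ k)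
    last k≤i₀ = subst P (toℕ-injective
      (≤-antisym (≤-trans (toℕ≤pred[n] i₀) (≤-reflexive (sym (toℕ-fromℕ k)))) k≤i₀)) p
    backwards : ∀ i → (toℕ (suc i) ≤ toℕ i₀ → P (suc i)) →
                toℕ (inject₁ i) ≤ toℕ i₀ → P (inject₁ i)
    backwards i ih i≤i₀ with suc (toℕ i) ≤? toℕ i₀
    ... | yes i<i₀ = closed (inject₁ i) (subst P (sym (next-inject₁ i)) (ih i<i₀))
    ... | no  i≮i₀ = subst P (toℕ-injective
      (≤-antisym (≤-trans (≮⇒≥ i≮i₀) (≤-reflexive (sym (toℕ-inject₁ i)))) i≤i₀)) p

record HamCycle (G : BG m n) (k : ℕ) : Set where
  field
    vertex     : Fin k → V m n
    injective  : Injective _≡_ _≡_ vertex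
    surjective : ∀ v → ∃ λ i → vertex i ≡ v
    adjacent   : ∀ i → Adj G (vertex i) (vertex (next i))

HamiltonianCycle⇒HamCycle : {G : BG m n} → HamiltonianCycle G → HamCycle G (m + n)
HamiltonianCycle⇒HamCycle (f , (_ , f-injective , f-adjacent) , f-surjective) = record
  { vertex = f ; injective = f-injective ; surjective = f-surjective
  ; adjacent = λ i → f-adjacent i (next i) (next-CycSucc i) }

Adj-ᵀ : (G : BG m n) → ∀ u v → Adj G u v → Adj (G ᵀ) (swap u) (swap v)
Adj-ᵀ G (inj₁ _) (inj₂ _) e = e
Adj-ᵀ G (inj₂ _) (inj₁ _) e = e

HamCycle-ᵀ : {G : BG m n} → HamCycle G k → HamCycle (G ᵀ) k
HamCycle-ᵀ {G = G} H = record
  { vertex     = swap ∘ vertex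
  ; injective  = λ e → injective (trans (sym (swap-involutive _)) (trans (cong swap e) (swap-involutive _)))
  ; surjective = λ v → let i , e = surjective (swap v) in i , trans (cong swap e) (swap-involutive v)
  ; adjacent   = λ i → Adj-ᵀ G (vertex i) (vertex (next i)) (adjacent i) }
  where open HamCycle H

module _ {G : BG m n} (H : HamCycle G k) where

  open HamCycle H

  position : Fin m → Fin k
  position a = proj₁ (surjective (inj₁ a))

  vertex-position : ∀ a → vertex (position a) ≡ inj₁ a
  vertex-position a = proj₂ (surjective (inj₁ a))

  private
    B-neighbour : ∀ {a} v → Adj G (inj₁ a) v → ∃ λ b → v ≡ inj₂ b × T (G a b)
    B-neighbour (inj₂ b) a~b = b , refl , a~b

    following : ∀ a → ∃ λ b → vertex (next (position a)) ≡ inj₂ b × T (G a b)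
    following a = B-neighbour _
      (subst (λ u → Adj G u (vertex (next (position a)))) (vertex-position a) (adjacent (position a)))

  successor : Fin m → Fin n
  successor a = proj₁ (following a)

  successor-adjacent : ∀ a → T (G a (successor a))
  successor-adjacent a = proj₂ (proj₂ (following a))

  predecessor-of-successor : ∀ {i a} → vertex (next i) ≡ inj₂ (successor a) → vertex i ≡ inj₁ a
  predecessor-of-successor {i} {a} e =
    trans (cong vertex (next-injective (injective (trans e (sym (proj₁ (proj₂ (following a))))))))
          (vertex-position a)

  successor-injective : Injective _≡_ _≡_ successor
  successor-injective {a} {a′} e = inj₁-injective (trans (sym (vertex-position a))
    (predecessor-of-successor (trans (proj₁ (proj₂ (following a))) (cong inj₂ e))))

  ham⇒m≤n : m ≤ n
  ham⇒m≤n = injective⇒≤ successor-injective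

  -- S ∪ N is closed under taking predecessors on the cycle.
  successors-covering⇒all : (S : Pred (Fin m) ℓ) (N : Pred (Fin n) ℓ) →
    (∀ {a b} → S a → T (G a b) → N b) → (∀ {b} → N b → ∃ λ a → S a × successor a ≡ b) →
    ∀ {a₀} → S a₀ → ∀ a → S a
  successors-covering⇒all S N neighbours⊆N N⊆successors {a₀} sa₀ a =
    subst X (vertex-position a) (closure (position a))
    where
    X : V m n → Set _
    X (inj₁ a) = S a
    X (inj₂ b) = N b
    predecessor : ∀ i u w → vertex i ≡ u → vertex (next i) ≡ w → Adj G u w → X w → X u
    predecessor i (inj₂ b) (inj₁ a) _    _       a~b sa = neighbours⊆N sa a~b
    predecessor i (inj₁ a) (inj₂ b) i↦a next↦b _   nb with N⊆successors nb
    ... | a′ , sa′ , refl = subst S (inj₁-injective (trans (sym (predecessor-of-successor next↦b)) i↦a)) sa′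
    closure : ∀ j → X (vertex j)
    closure = cycle-closure (X ∘ vertex)
      (λ i → predecessor i (vertex i) (vertex (next i)) refl refl (adjacent i))
      (subst X (sym (vertex-position a₀)) sa₀)

  module _ (2K2-free : TwoK2Free G) (t : ℕ) {a* : Fin m}
           (a*-max : ∀ a → U a × deg G a ≤ suc t → deg G a ≤ deg G a*) where

    private
      low? : Decidable (λ a → U a × deg G a ≤ suc t)
      low? a = U? a ×-dec deg G a ≤? suc t

      N? : Decidable (λ b → U b × T (G a* b))
      N? b = U? b ×-dec T? (G a* b)

      neighbours⊆N : ∀ {a b} → U a × deg G a ≤ suc t → T (G a b) → U b × T (G a* b)
      neighbours⊆N {a} {b} low ab = _ , neighbourhoods-nested 2K2-free U? a a* b (a*-max a low) _ ab

      successor-into-N : ∀ a → U a × deg G a ≤ suc t → U (successor a) × T (G a* (successor a))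
      successor-into-N a low = neighbours⊆N low (successor-adjacent a)

    few-low-vertices : suc t < m → deg G a* ≤ suc t → countLow (deg G) U? t ≤ t
    few-low-vertices t<m a*-low
      with count-injective-<⊎onto low? N? successor successor-into-N (λ _ _ → successor-injective)
    ... | inj₁ fewer = ≤-pred (<-≤-trans fewer a*-low)
    ... | inj₂ onto  = contradiction (begin
      m                      ≡⟨ count-all low? everything ⟨
      countLow (deg G) U? t  ≤⟨ count-injective low? N? successor successor-into-N (λ _ _ → successor-injective) ⟩
      deg G a*               ≤⟨ a*-low ⟩
      suc t                  ∎) (<⇒≱ t<m)
      where
      open ≤-Reasoning
      everything : ∀ a → U a × deg G a ≤ suc t
      everything = successors-covering⇒all _ _ neighbours⊆N (onto _) (_ , a*-low)

  ham⇒posa : TwoK2Free G → PosaCondition m (deg G) U?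
  ham⇒posa 2K2-free t t<m with any? (λ a → U? a ×-dec deg G a ≤? suc t)
  ... | no none        =
    ≤-trans (≤-reflexive (count-none (λ a → U? a ×-dec deg G a ≤? suc t) (λ a low → none (a , low)))) z≤n
  ... | yes (_ , low) with a* , (_ , a*-low) , a*-max ← argmax (deg G) (λ a → U? a ×-dec deg G a ≤? suc t) low
    = few-low-vertices 2K2-free t a*-max t<m a*-low

-- Pósa's condition forces a Hamiltonian cycle

VertexSet : Pred (Fin m) ℓ → Pred (Fin n) ℓ → V m n → Set ℓ
VertexSet SA SB (inj₁ a) = SA a
VertexSet SA SB (inj₂ b) = SB b

path : Fin n → List (V m n) → Fin m → List (V m n)
path b inner a = inj₂ b ∷ inner ++ inj₁ a ∷ []

record HamPath (G : BG m n) (SA : Pred (Fin m) ℓ) (SB : Pred (Fin n) ℓ) (z : Fin m) (k : ℕ) : Set ℓ where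
  field
    first    : Fin n
    inner    : List (V m n)
    last     : Fin m
    unique   : Unique (path first inner last)
    linked   : Linked (Adj G) (path first inner last)
    sound    : ∀ v → v ∈ path first inner last → VertexSet SA SB v
    complete : ∀ v → VertexSet SA SB v → v ∈ path first inner last
    length≡  : length (path first inner last) ≡ k + k
    z~first  : T (G z first)
    last∈SA  : SA last

module _ {G : BG m n} {SA : Pred (Fin m) ℓ} {SB : Pred (Fin n) ℓ} {a₁ : Fin m} {b₁ : Fin n}
         (sa₁ : SA a₁) (sb₁ : SB b₁) (a₁~b₁ : T (G a₁ b₁)) where

  singleton-path : ∀ {z} → T (G z b₁) → (∀ a → SA a → a ≡ a₁) → (∀ b → SB b → b ≡ b₁) →
                   HamPath G SA SB z 1
  singleton-path z~b₁ A≡a₁ B≡b₁ = record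
    { first = b₁ ; inner = [] ; last = a₁
    ; unique   = ((λ ()) ∷ []) ∷ [] ∷ []
    ; linked   = a₁~b₁ ∷ [-]
    ; sound    = λ { _ (here refl) → sb₁ ; _ (there (here refl)) → sa₁ }
    ; complete = λ { (inj₁ a) sa → there (here (cong inj₁ (A≡a₁ a sa)))
                   ; (inj₂ b) sb → here (cong inj₂ (B≡b₁ b sb)) }
    ; length≡  = refl ; z~first = z~b₁ ; last∈SA = sa₁ }

  prepend : ∀ {z k} → T (G z b₁) →
            HamPath G (λ a → SA a × a ≢ a₁) (λ b → SB b × b ≢ b₁) a₁ k → HamPath G SA SB z (suc k)
  prepend {z} {k} z~b₁ P = record
    { first = b₁ ; inner = inj₁ a₁ ∷ inj₂ P.first ∷ P.inner ; last = P.last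
    ; unique   = ((λ ()) ∷ ¬Any⇒All¬ old b₁∉old) ∷ ¬Any⇒All¬ old a₁∉old ∷ P.unique
    ; linked   = a₁~b₁ ∷ P.z~first ∷ P.linked
    ; sound    = λ { _ (here refl) → sb₁ ; _ (there (here refl)) → sa₁
                   ; v (there (there p)) → weaken v (P.sound v p) }
    ; complete = complete
    ; length≡  = cong suc (trans (cong suc P.length≡) (sym (+-suc k k)))
    ; z~first  = z~b₁ ; last∈SA = proj₁ P.last∈SA }
    where
    module P = HamPath P
    old : List (V m n)
    old = path P.first P.inner P.last
    b₁∉old : inj₂ b₁ ∉ old
    b₁∉old p = proj₂ (P.sound _ p) refl
    a₁∉old : inj₁ a₁ ∉ old
    a₁∉old p = proj₂ (P.sound _ p) refl
    weaken : ∀ v → VertexSet (λ a → SA a × a ≢ a₁) (λ b → SB b × b ≢ b₁) v → VertexSet SA SB v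
    weaken (inj₁ _) = proj₁
    weaken (inj₂ _) = proj₁
    complete : ∀ v → VertexSet SA SB v → v ∈ inj₂ b₁ ∷ inj₁ a₁ ∷ old
    complete (inj₁ a) sa with a ≟ a₁
    ... | yes refl = there (here refl)
    ... | no a≢a₁  = there (there (P.complete (inj₁ a) (sa , a≢a₁)))
    complete (inj₂ b) sb with b ≟ b₁
    ... | yes refl = here refl
    ... | no b≢b₁  = there (there (P.complete (inj₂ b) (sb , b≢b₁)))

-- b₁ ∈ N(z) is adjacent to every vertex of SA, so deleting b₁ and a vertex a₁ of minimum
-- degree lowers all degrees by one and preserves Pósa's condition; a₁ takes the role of z.
posa⇒hamPath : {G : BG m n} → TwoK2Free G → ∀ k {SA : Pred (Fin m) ℓ} {SB : Pred (Fin n) ℓ}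
               (SA? : Decidable SA) (SB? : Decidable SB) (z : Fin m) →
               count SA? ≡ suc k → count SB? ≡ suc k → PosaCondition (suc k) (degIn G SB?) SA? →
               (∀ a b → SA a → SB b → T (G z b) → T (G a b)) → 0 < degIn G SB? z →
               HamPath G SA SB z (suc k)
posa⇒hamPath {G = G} 2K2-free zero SA? SB? z |SA| |SB| posa dominated z-deg
  with b₁ , sb₁ , z~b₁ ← count-witness (λ b → SB? b ×-dec T? (G z b)) z-deg
  with a₁ , sa₁ ← count-witness SA? (≤-trans (s≤s z≤n) (≤-reflexive (sym |SA|)))
  = singleton-path sa₁ sb₁ (dominated a₁ b₁ sa₁ sb₁ z~b₁) z~b₁
      (λ a → count≡1⇒unique SA? |SA| sa₁ a) (λ b → count≡1⇒unique SB? |SB| sb₁ b)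
posa⇒hamPath {G = G} 2K2-free (suc k) SA? SB? z |SA| |SB| posa dominated z-deg
  with b₁ , sb₁ , z~b₁ ← count-witness (λ b → SB? b ×-dec T? (G z b)) z-deg
  with a₁ , sa₁ , minimal ← argmin (degIn G SB?) SA?
                              (proj₂ (count-witness SA? (≤-trans (s≤s z≤n) (≤-reflexive (sym |SA|)))))
  = prepend sa₁ sb₁ (dominated a₁ b₁ sa₁ sb₁ z~b₁) z~b₁
      (posa⇒hamPath 2K2-free k (remove? SA? a₁) (remove? SB? b₁) a₁
        (count-remove-≡ SA? sa₁ |SA|) (count-remove-≡ SB? sb₁ |SB|)
        (posa-remove-minimum (degIn G SB?) _ SA? sa₁ minimal (λ a _ _ → degIn-remove G SB? a b₁) posa)
        (λ a b (sa , _) (sb , _) → neighbourhoods-nested 2K2-free SB? a₁ a b (minimal a sa) sb)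
        a₁-degree)
  where
  a₁-degree : 0 < degIn G (remove? SB? b₁) a₁
  a₁-degree = ≤-pred (≤-trans (posa⇒1<degree (degIn G SB?) SA? posa sa₁) (degIn-remove G SB? a₁ b₁))

module _ {a} {A : Set a} where

  lookup-injective : {xs : List A} → Unique xs → ∀ {i j} → lookup xs i ≡ lookup xs j → i ≡ j
  lookup-injective (_ ∷ _)  {zero}  {zero}  _ = refl
  lookup-injective (x∉ ∷ _) {zero}  {suc j} e = contradiction e (All.lookup x∉ (∈-lookup j))
  lookup-injective (x∉ ∷ _) {suc i} {zero}  e = contradiction (sym e) (All.lookup x∉ (∈-lookup i))
  lookup-injective (_ ∷ xs) {suc i} {suc j} e = cong suc (lookup-injective xs e)

  Linked-lookup : ∀ {r} {R : Rel A r} {xs : List A} → Linked R xs →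
                  ∀ i j → toℕ j ≡ suc (toℕ i) → R (lookup xs i) (lookup xs j)
  Linked-lookup (r ∷ _)  zero    (suc zero)    _ = r
  Linked-lookup (_ ∷ rs) (suc i) (suc j)       e = Linked-lookup rs i j (suc-injective e)
  Linked-lookup [-]      zero    zero          ()
  Linked-lookup (_ ∷ _)  zero    zero          ()
  Linked-lookup (_ ∷ _)  zero    (suc (suc _)) ()
  Linked-lookup (_ ∷ _)  (suc _) zero          ()

  lookup-∷ʳ : ∀ (xs : List A) x i → toℕ i ≡ length xs → lookup (xs ++ x ∷ []) i ≡ x
  lookup-∷ʳ []       x zero    _ = refl
  lookup-∷ʳ (_ ∷ xs) x (suc i) e = lookup-∷ʳ xs x i (suc-injective e)

hamPath⇒HamiltonianCycle : {G : BG m n} {z : Fin m} {k : ℕ} → 3 ≤ m + n → m + n ≡ k + k →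
                           (P : HamPath G U U z k) → T (G (HamPath.last P) (HamPath.first P)) →
                           HamiltonianCycle G
hamPath⇒HamiltonianCycle {m = m} {n} {G} 3≤m+n m+n≡ P last~first =
  f , (3≤m+n , f-injective , f-adjacent) , f-surjective
  where
  open HamPath P
  L : List (V m n)
  L = path first inner last
  m+n≡|L| : m + n ≡ length L
  m+n≡|L| = trans m+n≡ (sym length≡)
  f : Fin (m + n) → V m n
  f i = lookup L (cast m+n≡|L| i)
  toℕ-cast′ : ∀ i → toℕ (cast m+n≡|L| i) ≡ toℕ i
  toℕ-cast′ = toℕ-cast m+n≡|L|
  f-injective : Injective _≡_ _≡_ f
  f-injective {i} {j} e = toℕ-injective (trans (sym (toℕ-cast′ i))
                            (trans (cong toℕ (lookup-injective unique {cast m+n≡|L| i} {cast m+n≡|L| j} e))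
                                   (toℕ-cast′ j)))
  f-adjacent : ∀ i j → CycSucc (m + n) i j → Adj G (f i) (f j)
  f-adjacent i j (inj₁ j≡1+i) =
    Linked-lookup linked _ _ (trans (toℕ-cast′ j) (trans j≡1+i (cong suc (sym (toℕ-cast′ i)))))
  f-adjacent i j (inj₂ (1+i≡m+n , j≡0)) = subst₂ (Adj G) (sym f-i≡last) (sym f-j≡first) last~first
    where
    f-i≡last : f i ≡ inj₁ last
    f-i≡last = lookup-∷ʳ (inj₂ first ∷ inner) (inj₁ last) (cast m+n≡|L| i) (suc-injective (begin-equality
      suc (toℕ (cast m+n≡|L| i))            ≡⟨ cong suc (toℕ-cast′ i) ⟩
      suc (toℕ i)                           ≡⟨ trans 1+i≡m+n m+n≡|L| ⟩
      length L                              ≡⟨ length-++ (inj₂ first ∷ inner) ⟩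
      length (inj₂ first ∷ inner) + 1       ≡⟨ +-comm _ 1 ⟩
      suc (length (inj₂ first ∷ inner))     ∎))
      where open ≤-Reasoning
    f-j≡first : f j ≡ inj₂ first
    f-j≡first with cast m+n≡|L| j | toℕ-cast′ j
    ... | zero | _ = refl
    ... | suc _ | j′≡j = contradiction (trans j′≡j j≡0) (λ ())
  f-surjective : ∀ v → ∃ λ i → f i ≡ v
  f-surjective v = cast (sym m+n≡|L|) (index v∈L) ,
                   trans (cong (lookup L) (cast-involutive m+n≡|L| (sym m+n≡|L|) _)) (sym (lookup-index v∈L))
    where
    everything : ∀ v → VertexSet U U v
    everything (inj₁ _) = _
    everything (inj₂ _) = _
    v∈L : v ∈ L
    v∈L = complete v (everything v)

-- Orderings of A₂ and B₂, and maximal bicliques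

card≡count : (p : Subset n) → card p ≡ count (_∈? p)
card≡count []            = refl
card≡count (inside ∷ p)  = cong suc (trans (card≡count p)
  (count-≐ (_∈? p) (λ i → suc i ∈? inside ∷ p) (λ _ → Vec.there) (λ _ → drop-there)))
card≡count (outside ∷ p) = trans (card≡count p)
  (count-≐ (_∈? p) (λ i → suc i ∈? outside ∷ p) (λ _ → Vec.there) (λ _ → drop-there))

card-tabulate : (P : Fin n → Bool) → card (tabulate P) ≡ count (λ i → U? i ×-dec T? (P i))
card-tabulate {zero}  P = refl
card-tabulate {suc n} P with P zero
... | true  = cong suc (card-tabulate (P ∘ suc))
... | false = card-tabulate (P ∘ suc)

degA≡deg : (G : BG m n) (a : Fin m) → degA G a ≡ deg G a
degA≡deg G a = card-tabulate (G a)

goodOrderA⇒posa : {G : BG m n} {S : Subset m} → GoodOrderA G S → ∀ t → countLow (deg G) (_∈? S) t ≤ t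
goodOrderA⇒posa {G = G} {S} (u , u-injective , u∈S , u-degree) =
  ordering⇒posa (deg G) (_∈? S) (sym (card≡count S))
    (u , u-injective , u∈S , λ i → subst (suc (toℕ i) <_) (degA≡deg G (u i)) (u-degree i))

posa⇒goodOrderA : {G : BG m n} {S : Subset m} → PosaCondition (suc (card S)) (deg G) (_∈? S) → GoodOrderA G S
posa⇒goodOrderA {G = G} {S} posa
  with u , u-injective , u∈S , u-degree ← posa⇒ordering (deg G) (_∈? S) (sym (card≡count S)) posa
  = u , u-injective , u∈S , λ i → subst (suc (toℕ i) <_) (sym (degA≡deg G (u i))) (u-degree i)

MaximalBiclique-ᵀ : {G : BG m n} {X : Subset m} {Y : Subset n} → MaximalBiclique G X Y → MaximalBiclique (G ᵀ) Y X
MaximalBiclique-ᵀ (biclique , maximalˡ , maximalʳ) =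
  (λ b a b∈Y a∈X → biclique a b a∈X b∈Y) ,
  (λ b b∉Y extended → maximalʳ b b∉Y (λ a b′ a∈X b′∈ → extended b′ a b′∈ a∈X)) ,
  (λ a a∉X extended → maximalˡ a a∉X (λ a′ b a′∈ b∈Y → extended b a′ b∈Y a′∈))

adjacent-to-all⇒∈ : {G : BG m n} {X : Subset m} {Y : Subset n} → MaximalBiclique G X Y →
                    ∀ {a} → (∀ b → b ∈ₛ Y → T (G a b)) → a ∈ₛ X
adjacent-to-all⇒∈ {G = G} {X} {Y} (biclique , maximalˡ , _) {a} a~Y with a ∈? X
... | yes a∈X = a∈X
... | no a∉X  = contradiction extended (maximalˡ a a∉X)
  where
  extended : Biclique G (⁅ a ⁆ ∪ X) Y
  extended a′ b a′∈ b∈Y with x∈p∪q⁻ ⁅ a ⁆ X a′∈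
  ... | inj₁ a′∈⁅a⁆ = subst (λ x → T (G x b)) (sym (x∈⁅y⁆⇒x≡y a a′∈⁅a⁆)) (a~Y b b∈Y)
  ... | inj₂ a′∈X   = biclique a′ b a′∈X b∈Y

private
  +-≤-complement : ∀ {x y p q} → x + y ≡ p + q → x ≤ p → q ≤ y
  +-≤-complement {x} {y} {p} {q} e x≤p = +-cancelˡ-≤ p q y (≤-trans (≤-reflexive (sym e)) (+-monoˡ-≤ y x≤p))

posa⇒full-vertex : {G : BG m n} → PosaCondition m (deg G) U? → m ≡ n → 2 ≤ m → ∃ λ a → ∀ b → T (G a b)
posa⇒full-vertex {m = suc zero} _ _ (s≤s ())
posa⇒full-vertex {m = suc (suc k)} {G = G} posa refl _
  with a , a-high ← count-witness (∁? (λ a → U? a ×-dec deg G a ≤? suc k))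
                      (+-≤-complement (trans (count-complement (λ a → U? a ×-dec deg G a ≤? suc k)) (+-comm 1 (suc k)))
                                      (≤-trans (posa k ≤-refl) (n≤1+n k)))
  = a , proj₂ ∘ count≥n⇒all (λ b → U? b ×-dec T? (G a b)) (≰⇒> (a-high ∘ (_ ,_)))

posa-on-complement : {G : BG m n} {X : Subset m} {x : Fin m} → x ∈ₛ X →
                     PosaCondition m (deg G) U? → PosaCondition (suc (card (∁ X))) (deg G) (_∈? ∁ X)
posa-on-complement {m} {G = G} {X} x∈X posa t t<1+|∁X| =
  ≤-trans (count-mono (λ a → (a ∈? ∁ X) ×-dec deg G a ≤? suc t) (λ a → U? a ×-dec deg G a ≤? suc t)
                      (λ _ (_ , low) → _ , low))
          (posa t (begin-strict
            suc t               ≤⟨ ≤-pred t<1+|∁X| ⟩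
            card (∁ X)          ≡⟨ card≡count (∁ X) ⟩
            count (_∈? ∁ X)     <⟨ count-⊂ (_∈? ∁ X) U? (λ _ _ → _) _ (x∈p⇒x∉∁p x∈X) ⟩
            count {m} U?        ≡⟨ count-all U? _ ⟩
            m                   ∎))
  where open ≤-Reasoning

posa⇒goodOrder : {G : BG m n} {A₁ : Subset m} {B₁ : Subset n} → MaximalBiclique G A₁ B₁ → m ≡ n → 2 ≤ m →
                 PosaCondition m (deg G) U? → GoodOrderA G (∁ A₁)
posa⇒goodOrder {G = G} maximal m≡n 2≤m posa with a , full ← posa⇒full-vertex {G = G} posa m≡n 2≤m
  = posa⇒goodOrderA {G = G} (posa-on-complement {G = G} (adjacent-to-all⇒∈ maximal (λ b _ → full b)) posa)

-- If a vertex a₁ ∈ A₁ has degree ≤ t + 1, then B₁ ⊆ N(a₁) ⊆ N(a₀) for the vertex a₀ of largest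
-- degree ≤ t + 1; the non-neighbours of a₀ then lie in B₂ and all have degree at most the number
-- of vertices of degree > t + 1, and there are too many of them for Pósa's condition on B₂.
complement-posa⇒posa : {G : BG m n} → TwoK2Free G → m ≡ n → {A₁ : Subset m} {B₁ : Subset n} →
                       Biclique G A₁ B₁ →
                       (∀ t → countLow (deg G) (_∈? ∁ A₁) t ≤ t) →
                       (∀ t → countLow (deg (G ᵀ)) (_∈? ∁ B₁) t ≤ t) →
                       PosaCondition m (deg G) U?
complement-posa⇒posa {m} {G = G} 2K2-free refl {A₁} {B₁} biclique posaA posaB t t<m
  with any? (λ a → (a ∈? A₁) ×-dec deg G a ≤? suc t)
... | no none = ≤-trans (count-mono low? (λ a → (a ∈? ∁ A₁) ×-dec deg G a ≤? suc t) outside-A₁) (posaA t)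
  where
  low? : Decidable (λ a → U a × deg G a ≤ suc t)
  low? a = U? a ×-dec deg G a ≤? suc t
  outside-A₁ : ∀ a → U a × deg G a ≤ suc t → a ∈ₛ ∁ A₁ × deg G a ≤ suc t
  outside-A₁ a (_ , low) = x∉p⇒x∈∁p (λ a∈A₁ → none (a , a∈A₁ , low)) , low
... | yes (a₁ , a₁∈A₁ , a₁-low) with countLow (deg G) U? t ≤? t
...   | yes few = few
...   | no many
  with a₀ , (_ , a₀-low) , a₀-max ← argmax (deg G) (λ a → U? a ×-dec deg G a ≤? suc t) (_ , a₁-low)
  with s , m≡ ← m≤n⇒∃[o]m+o≡n t<m
  = contradiction (posaB s) (<⇒≱ (begin-strict
      s                                          <⟨ n<1+n s ⟩
      suc s                                      ≤⟨ +-≤-complement (trans (count-complement N₀?) m≡t+s) a₀-low ⟩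
      count (∁? N₀?)                             ≤⟨ count-mono (∁? N₀?) _ non-neighbour-low ⟩
      countLow (deg (G ᵀ)) (_∈? ∁ B₁) s          ∎))
  where
  open ≤-Reasoning
  m≡t+s : m ≡ suc t + suc s
  m≡t+s = trans (sym m≡) (sym (+-suc (suc t) s))
  N₀? : Decidable (λ b → U b × T (G a₀ b))
  N₀? b = U? b ×-dec T? (G a₀ b)
  adjacent-to-a₀ : ∀ {a b} → deg G a ≤ suc t → T (G a b) → T (G a₀ b)
  adjacent-to-a₀ {a} {b} low ab = neighbourhoods-nested 2K2-free U? a a₀ b (a₀-max a (_ , low)) _ ab
  high≤ : count (∁? (λ a → U? a ×-dec deg G a ≤? suc t)) ≤ suc s
  high≤ = +-≤-complement (sym (trans (count-complement (λ a → U? a ×-dec deg G a ≤? suc t)) m≡t+s)) (≰⇒> many)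
  non-neighbour-low : ∀ b → ¬ (U b × T (G a₀ b)) → b ∈ₛ ∁ B₁ × deg (G ᵀ) b ≤ suc s
  non-neighbour-low b ¬a₀b =
    x∉p⇒x∈∁p (λ b∈B₁ → ¬a₀b (_ , adjacent-to-a₀ a₁-low (biclique a₁ b a₁∈A₁ b∈B₁))) ,
    ≤-trans (count-mono (λ a → U? a ×-dec T? (G a b)) _ (λ a (_ , ab) (_ , low) → ¬a₀b (_ , adjacent-to-a₀ low ab)))
            high≤

posa⇒HamiltonianCycle : {G : BG m n} → TwoK2Free G → 3 ≤ m + n → m ≡ n → PosaCondition m (deg G) U? →
                        HamiltonianCycle G
posa⇒HamiltonianCycle {zero} {zero} _ () refl _
posa⇒HamiltonianCycle {suc zero} {suc zero} _ (s≤s (s≤s ())) refl _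
posa⇒HamiltonianCycle {suc (suc k)} {G = G} 2K2-free 3≤m+n refl posa
  with z , _ , z-min ← argmin (deg G) U? {zero} _
  = hamPath⇒HamiltonianCycle 3≤m+n refl P (dominated P.last P.first _ _ P.z~first)
  where
  dominated : ∀ a b → U a → U b → T (G z b) → T (G a b)
  dominated a b _ _ = neighbourhoods-nested {G = G} 2K2-free U? z a b (z-min a _) _
  z-degree : 0 < deg G z
  z-degree = ≤-trans (s≤s z≤n) (posa⇒1<degree (deg G) U? posa _)
  P : HamPath G U U z (suc (suc k))
  P = posa⇒hamPath 2K2-free (suc k) U? U? z (count-all U? _) (count-all U? _) posa dominated z-degree
  module P = HamPath P

private
  3≤m+n⇒2≤m : 3 ≤ m + n → m ≡ n → 2 ≤ m
  3≤m+n⇒2≤m {zero}        {zero}     ()                 refl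
  3≤m+n⇒2≤m {suc zero}     {suc zero} (s≤s (s≤s ()))     refl
  3≤m+n⇒2≤m {suc (suc m)}  _          refl = s≤s (s≤s z≤n)

theorem2 : ∀ {m n : ℕ} (G : BG m n) → 3 ≤ m + n → Connected G → P5Free G →
    ChordalBipartite G → (A₁ : Subset m) (B₁ : Subset n) → MaximumBiclique G A₁ B₁ →
    HamiltonianCycle G ⇔ ((m ≡ n) × GoodOrderA G (∁ A₁) × GoodOrderB G (∁ B₁))
theorem2 {m} {n} G 3≤m+n connected p5-free _ A₁ B₁ (maximal , _) = mk⇔ necessary sufficient
  where
  2K2-free : TwoK2Free G
  2K2-free = connected-P5free⇒2K2free p5-free connected
  necessary : HamiltonianCycle G → (m ≡ n) × GoodOrderA G (∁ A₁) × GoodOrderB G (∁ B₁)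
  necessary ham = m≡n ,
    posa⇒goodOrder {G = G} maximal m≡n 2≤m (ham⇒posa H 2K2-free) ,
    posa⇒goodOrder {G = G ᵀ} (MaximalBiclique-ᵀ maximal) (sym m≡n) (subst (2 ≤_) m≡n 2≤m)
      (ham⇒posa (HamCycle-ᵀ H) (TwoK2Free-ᵀ {G = G} 2K2-free))
    where
    H : HamCycle G (m + n)
    H = HamiltonianCycle⇒HamCycle ham
    m≡n : m ≡ n
    m≡n = ≤-antisym (ham⇒m≤n H) (ham⇒m≤n (HamCycle-ᵀ H))
    2≤m : 2 ≤ m
    2≤m = 3≤m+n⇒2≤m 3≤m+n m≡n
  sufficient : (m ≡ n) × GoodOrderA G (∁ A₁) × GoodOrderB G (∁ B₁) → HamiltonianCycle G
  sufficient (m≡n , goodA , goodB) = posa⇒HamiltonianCycle 2K2-free 3≤m+n m≡n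
    (complement-posa⇒posa 2K2-free m≡n (proj₁ maximal)
      (goodOrderA⇒posa {G = G} goodA) (goodOrderA⇒posa {G = G ᵀ} goodB))
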